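{- Let $G$ be a finite connected simple graph and suppose there is a positive integer $\delta$ such that (C1) every essential vertex of $G$ has degree $\delta$, and (C2) for every $2$-connected induced factor-critical subgraph $H$ of $G$, $|E(H)|=(\delta+1)\frac{|V(H)|-1}{2}-1$. Then: (i) if $\delta=3$, every odd cycle of $G$ has length at most $5$, and if $G$ contains a $5$-cycle $C$, then the induced subgraph $G[V(C)]$ is isomorphic to $C'_5$; (ii) if $\delta\ge4$, then $G$ is bipartite.
   Context: A vertex $u$ of $G$ is essential if (1) $\deg_G(u)=1$ and its neighbor also has degree $1$, or (2) $\deg_G(u)=2$ and its two neighbors are not adjacent, or (3) $\deg_G(u)\ge 3$. A graph $H$ is factor-critical if for every vertex $u$ of $H$, $H\setminus u$ has a perfect matching. A graph is $2$-connected if it has at least $3$ vertices, is connected, and has no cut vertex. $C'_5$ is the graph on vertex set $\mathbb{Z}_5$ with edges $\{i,i+1\}$ ($i\in\mathbb{Z}_5$) together with the chords $\{1,3\},\{2,4\}$. -}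

module Defs where

open import Data.Nat using (ℕ; zero; suc; _+_; _*_; _∸_; _≤_; _<_; _<ᵇ_)
open import Data.Nat.DivMod using (_/_)
open import Data.Bool using (Bool; true; false; _∧_; if_then_else_)
open import Data.Fin using (Fin; zero; suc; toℕ; inject₁; fromℕ; _≟_)
open import Data.List using (List; map; allFin)
open import Data.Nat.ListAction using (sum)
open import Data.Product using (Σ; ∃; _×_; _,_)
open import Data.Sum using (_⊎_)
open import Relation.Nullary using (¬_; does)
open import Relation.Binary.PropositionalEquality using (_≡_; _≢_)
open import Function.Definitions using (Injective)
open import Function.Bundles using (_↔_; Inverse)

record Graph (n : ℕ) : Set where
  field
    Adj   : Fin n → Fin n → Bool
    sym   : ∀ u v → Adj u v ≡ Adj v u
    irrefl : ∀ u → Adj u u ≡ false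
open Graph public

VSet : ℕ → Set
VSet n = Fin n → Bool

b2n : Bool → ℕ
b2n true = 1
b2n false = 0

∣_∣ˢ : ∀ {n} → VSet n → ℕ
∣_∣ˢ {n} S = sum (map (λ i → b2n (S i)) (allFin n))

_-ᵛ_ : ∀ {n} → VSet n → Fin n → VSet n
(S -ᵛ u) v = if does (v ≟ u) then false else S v

full : ∀ {n} → VSet n
full _ = true

deg : ∀ {n} → Graph n → Fin n → ℕ
deg {n} G u = sum (map (λ v → b2n (Adj G u v)) (allFin n))

edgesIn : ∀ {n} → Graph n → VSet n → ℕ
edgesIn {n} G S =
  sum (map (λ u → sum (map (λ v →
        b2n (S u ∧ S v ∧ Adj G u v ∧ (toℕ u <ᵇ toℕ v)))
      (allFin n))) (allFin n))

Essential : ∀ {n} → Graph n → Fin n → Set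
Essential G u =
    (deg G u ≡ 1 × (∀ v → Adj G u v ≡ true → deg G v ≡ 1))
  ⊎ (deg G u ≡ 2 × (∀ v w → Adj G u v ≡ true → Adj G u w ≡ true → v ≢ w → Adj G v w ≡ false))
  ⊎ (3 ≤ deg G u)

data Reach {n} (G : Graph n) (S : VSet n) : Fin n → Fin n → Set where
  here : ∀ {x} → S x ≡ true → Reach G S x x
  step : ∀ {x y z} → S x ≡ true → Adj G x y ≡ true → Reach G S y z → Reach G S x z

ConnectedOn : ∀ {n} → Graph n → VSet n → Set
ConnectedOn G S = ∀ x y → S x ≡ true → S y ≡ true → Reach G S x y

Connected : ∀ {n} → Graph n → Set
Connected G = ConnectedOn G full

TwoConnectedOn : ∀ {n} → Graph n → VSet n → Set
TwoConnectedOn G S =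
  3 ≤ ∣ S ∣ˢ × ConnectedOn G S × (∀ u → S u ≡ true → ConnectedOn G (S -ᵛ u))

-- G[T] has a perfect matching (given as the partner map, an involution on T along edges)
HasPerfectMatchingOn : ∀ {n} → Graph n → VSet n → Set
HasPerfectMatchingOn {n} G T =
  Σ (Fin n → Fin n) λ m → ∀ v → T v ≡ true →
    T (m v) ≡ true × Adj G v (m v) ≡ true × m (m v) ≡ v

FactorCriticalOn : ∀ {n} → Graph n → VSet n → Set
FactorCriticalOn G S = ∀ u → S u ≡ true → HasPerfectMatchingOn G (S -ᵛ u)

-- a cycle of length suc m in G (vertices c 0, ..., c m, pairwise distinct, m+1 ≥ 3)
record Cycle {n} (G : Graph n) (m : ℕ) : Set where
  field
    vtx    : Fin (suc m) → Fin n
    long   : 3 ≤ suc m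
    inj    : Injective _≡_ _≡_ vtx
    edge   : ∀ (i : Fin m) → Adj G (vtx (inject₁ i)) (vtx (suc i)) ≡ true
    close  : Adj G (vtx (fromℕ m)) (vtx zero) ≡ true
open Cycle public

len : ∀ {n} {G : Graph n} {m} → Cycle G m → ℕ
len {m = m} _ = suc m

data Odd : ℕ → Set where
  one : Odd 1
  ss  : ∀ {k} → Odd k → Odd (suc (suc k))

-- C'_5 on Z_5: edges {i,i+1} and chords {1,3}, {2,4}
C5'adj : Fin 5 → Fin 5 → Bool
C5'adj i j = edgeNum (toℕ i) (toℕ j)
  where
  edgeNum : ℕ → ℕ → Bool
  edgeNum 0 1 = true
  edgeNum 1 0 = true
  edgeNum 1 2 = true
  edgeNum 2 1 = true
  edgeNum 2 3 = true
  edgeNum 3 2 = true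
  edgeNum 3 4 = true
  edgeNum 4 3 = true
  edgeNum 4 0 = true
  edgeNum 0 4 = true
  edgeNum 1 3 = true
  edgeNum 3 1 = true
  edgeNum 2 4 = true
  edgeNum 4 2 = true
  edgeNum _ _ = false

Isomorphic : ∀ {k l} → (Fin k → Fin k → Bool) → (Fin l → Fin l → Bool) → Set
Isomorphic {k} {l} A B =
  Σ (Fin k ↔ Fin l) λ φ → ∀ i j → A i j ≡ B (Inverse.to φ i) (Inverse.to φ j)

-- the induced subgraph G[V(C)] of a 5-cycle C, with vertices indexed via the
-- (injective) cycle map
inducedOnCycle : ∀ {n} {G : Graph n} → Cycle G 4 → Fin 5 → Fin 5 → Bool
inducedOnCycle {G = G} C i j = Adj G (vtx C i) (vtx C j)

Bipartite : ∀ {n} → Graph n → Set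
Bipartite {n} G = Σ (Fin n → Bool) λ col → ∀ u v → Adj G u v ≡ true → col u ≢ col v

module Submission where

-- A cycle C of odd length 2j + 1 induces a 2-connected factor-critical subgraph: deleting any
-- vertex leaves a path on an even number of vertices, matched in consecutive pairs. So by (C2)
-- G[V(C)] has (δ + 1)j − 1 edges, and by the handshake lemma twice that is the degree sum of
-- G[V(C)].
-- For δ = 3 all degrees are at most 3 (a vertex of larger degree is essential), so
-- 8j − 2 ≤ 3(2j + 1) and j ≤ 2; a 5-cycle then spans 7 edges without a vertex of degree 4,
-- and the only such graphs are the rotations of C'_5.
-- For δ ≥ 4 a shortest odd closed walk is a cycle (split it at a repeated vertex) without
-- chords (split it along the chord), so its degree sum is 2(2j + 1) < 2((δ + 1)j − 1).
-- Hence all closed walks are even, and the parity of walks from a fixed vertex 2-colours G.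

open import Data.Nat.Properties hiding (_≟_)
open import Algebra.Properties.CommutativeMonoid.Sum +-0-commutativeMonoid
  using (∑-distrib-+; ∑-comm; sum-cong-≗; sum-replicate-zero; sum-syntax) renaming (sum to ∑)
open import Algebra.Properties.Semiring.Sum +-*-semiring using (*-distribˡ-sum)
open import Data.Bool using (Bool; true; false; _∧_; _∨_; not; _xor_; if_then_else_)
open import Data.Bool.Properties using (not-involutive)
open import Data.Empty using (⊥; ⊥-elim)
open import Data.Fin using (Fin; zero; suc; toℕ; inject₁; fromℕ; _≟_)
open import Data.Fin.Properties using (toℕ-injective)
open import Data.List using (List; []; _∷_; _++_; [_]; length; map; tabulate; allFin)
open import Data.List.Properties using (length-++; map-tabulate; length-tabulate; ++-assoc)
open import Data.List.Membership.Propositional using (_∈_; find)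
open import Data.List.Membership.Propositional.Properties using (∈-∃++)
open import Data.List.Relation.Binary.Permutation.Propositional using (_↭_; ↭-trans; ↭-sym; prep; ↭⇒↭ₛ)
open import Data.List.Relation.Binary.Permutation.Propositional.Properties
  using (shift; ++-comm; ↭-length; ∈-resp-↭; map⁺)
import Data.List.Relation.Binary.Permutation.Setoid.Properties as PermutationSetoid
open import Data.List.Relation.Unary.All as All using (All)
open import Data.List.Relation.Unary.All.Properties using (¬Any⇒All¬; ¬All⇒Any¬)
open import Data.List.Relation.Unary.AllPairs using ([]; _∷_)
open import Data.List.Relation.Unary.Any using (here; there)
open import Data.List.Relation.Unary.Unique.Propositional using (Unique)
open import Data.List.Relation.Unary.Unique.Propositional.Properties using (Unique[x∷xs]⇒x∉xs; tabulate⁺)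
open import Data.Nat using (ℕ; zero; suc; _+_; _*_; _∸_; _≤_; _<_; _≤?_; _<ᵇ_; z≤n; s≤s; s≤s⁻¹)
open import Data.Nat.DivMod using (_/_; m*n/n≡m)
open import Data.Nat.Induction using (<-rec)
open import Data.Nat.ListAction using (sum)
open import Data.Nat.ListAction.Properties using (sum-↭)
open import Data.Nat.Tactic.RingSolver using (solve-∀)
open import Data.Product using (∃; ∃-syntax; _×_; _,_; proj₁; proj₂)
open import Data.Sum using (_⊎_; inj₁; inj₂)
open import Function using (_∘_; id)
open import Relation.Binary.Definitions using (DecidableEquality)
open import Relation.Binary.PropositionalEquality
  using (_≡_; _≢_; refl; sym; trans; cong; cong₂; subst; subst₂; _≗_; module ≡-Reasoning)
open import Relation.Binary.PropositionalEquality.Properties using (setoid)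
open import Relation.Nullary using (does; yes; no)
open import Relation.Nullary.Decidable using (dec-true; dec-false)

open import Defs hiding (sym)

b2n-∧ : ∀ a b → b2n (a ∧ b) ≡ b2n a * b2n b
b2n-∧ true b = sym (+-identityʳ (b2n b))
b2n-∧ false b = refl

b2n≤1 : ∀ b → b2n b ≤ 1
b2n≤1 true = s≤s z≤n
b2n≤1 false = z≤n

<ᵇ-exclusive : ∀ {a b} → a ≢ b → b2n (a <ᵇ b) + b2n (b <ᵇ a) ≡ 1
<ᵇ-exclusive {zero} {zero} a≢b = ⊥-elim (a≢b refl)
<ᵇ-exclusive {zero} {suc b} _ = refl
<ᵇ-exclusive {suc a} {zero} _ = refl
<ᵇ-exclusive {suc a} {suc b} a≢b = <ᵇ-exclusive (a≢b ∘ cong suc)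

odd? : ℕ → Bool
odd? zero = false
odd? (suc k) = not (odd? k)

odd?-+2 : ∀ k → odd? (suc (suc k)) ≡ odd? k
odd?-+2 k = not-involutive (odd? k)

odd?-+ : ∀ m n → odd? (m + n) ≡ odd? m xor odd? n
odd?-+ zero n = refl
odd?-+ (suc m) n rewrite odd?-+ m n with odd? m
... | true = not-involutive (odd? n)
... | false = refl

odd?-summand : ∀ m n → odd? (m + n) ≡ true → odd? m ≡ true ⊎ odd? n ≡ true
odd?-summand m n odd rewrite odd?-+ m n with odd? m
... | true = inj₁ refl
... | false = inj₂ odd

odd?-suc+suc : ∀ m n → odd? (suc m + suc n) ≡ odd? (m + n)
odd?-suc+suc m n = trans (cong (odd? ∘ suc) (+-suc m n)) (odd?-+2 (m + n))

odd?-+suc : ∀ {m n} → odd? m ≡ odd? n → odd? (m + suc n) ≡ true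
odd?-+suc {m} {n} same rewrite odd?-+ m (suc n) | same with odd? n
... | true = refl
... | false = refl

Odd⇒odd? : ∀ {k} → Odd k → odd? k ≡ true
Odd⇒odd? one = refl
Odd⇒odd? (ss {k} o) = trans (odd?-+2 k) (Odd⇒odd? o)

odd?⇒≡1+2j : ∀ k → odd? k ≡ true → ∃ λ j → k ≡ suc (j * 2)
odd?⇒≡1+2j (suc zero) _ = 0 , refl
odd?⇒≡1+2j (suc (suc k)) odd with odd?⇒≡1+2j k (trans (sym (odd?-+2 k)) odd)
... | j , refl = suc j , refl

sum-tabulate : ∀ {n} (f : Fin n → ℕ) → sum (tabulate f) ≡ ∑ f
sum-tabulate {zero} f = refl
sum-tabulate {suc n} f = cong (f zero +_) (sum-tabulate (f ∘ suc))

sum-map-tabulate : ∀ {A : Set} {n} (f : Fin n → A) (g : A → ℕ) → sum (map g (tabulate f)) ≡ ∑ (g ∘ f)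
sum-map-tabulate f g = trans (cong sum (map-tabulate f g)) (sum-tabulate (g ∘ f))

sum-allFin : ∀ {n} (g : Fin n → ℕ) → sum (map g (allFin n)) ≡ ∑ g
sum-allFin = sum-map-tabulate id

sum-map-≤ : ∀ {A : Set} {f : A → ℕ} {c xs} → All (λ x → f x ≤ c) xs → sum (map f xs) ≤ length xs * c
sum-map-≤ All.[] = z≤n
sum-map-≤ (fx≤c All.∷ rest) = +-mono-≤ fx≤c (sum-map-≤ rest)

∑-mono-≤ : ∀ {n} {f g : Fin n → ℕ} → (∀ i → f i ≤ g i) → ∑ f ≤ ∑ g
∑-mono-≤ {zero} f≤g = z≤n
∑-mono-≤ {suc n} f≤g = +-mono-≤ (f≤g zero) (∑-mono-≤ (f≤g ∘ suc))

∑-indicator : ∀ {n} (x : Fin n) (f : Fin n → ℕ) → ∑[ w < n ] (b2n (does (w ≟ x)) * f w) ≡ f x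
∑-indicator {suc n} zero f = begin
  f zero + 0 + ∑[ w < n ] 0  ≡⟨ cong (f zero + 0 +_) (sum-replicate-zero n) ⟩
  f zero + 0 + 0             ≡⟨ +-identityʳ _ ⟩
  f zero + 0                 ≡⟨ +-identityʳ _ ⟩
  f zero                     ∎
  where open ≡-Reasoning
∑-indicator {suc n} (suc x) f = ∑-indicator x (f ∘ suc)

summands< : ∀ {x y L} → 1 ≤ x → 1 ≤ y → x + y ≡ L → x < L × y < L
summands< {x} {y} 1≤x 1≤y refl = m<m+n x 1≤y , m<n+m y 1≤x

suc-summands< : ∀ {x y L} → 2 ≤ x → 2 ≤ y → x + y ≡ L → suc x < L × suc y < L
suc-summands< {x} {y} 2≤x 2≤y refl = suc<+ x y 2≤y , subst (suc y <_) (+-comm y x) (suc<+ y x 2≤x)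
  where
  suc<+ : ∀ x y → 2 ≤ y → suc x < x + y
  suc<+ x (suc y) (s≤s 1≤y) = subst (suc x <_) (sym (+-suc x y)) (s≤s (m<m+n x 1≤y))

*-suc∸1 : ∀ c i → suc c * suc i ∸ 1 ≡ c + i * suc c
*-suc∸1 c i = rearrange c i
  where
  rearrange : ∀ c i → i + c * suc i ≡ c + i * suc c
  rearrange = solve-∀

cycleDegreeSum<criticalEdges : ∀ δ i → 4 ≤ δ → (3 + i * 2) * 2 < 2 * ((δ + 1) * suc i ∸ 1)
cycleDegreeSum<criticalEdges δ i δ≥4 = begin-strict
  (3 + i * 2) * 2                      <⟨ s≤s (m≤m+n _ (1 + i * 6)) ⟩
  suc ((3 + i * 2) * 2 + (1 + i * 6))  ≡⟨ rearrange i ⟩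
  2 * (4 + i * 5)                      ≤⟨ *-monoʳ-≤ 2 (+-mono-≤ δ≥4 (*-monoʳ-≤ i (s≤s δ≥4))) ⟩
  2 * (δ + i * suc δ)                  ≡⟨ cong (2 *_) (*-suc∸1 δ i) ⟨
  2 * (suc δ * suc i ∸ 1)              ≡⟨ cong (λ d → 2 * (d * suc i ∸ 1)) (+-comm 1 δ) ⟩
  2 * ((δ + 1) * suc i ∸ 1)            ∎
  where
  open ≤-Reasoning
  rearrange : ∀ i → suc ((3 + i * 2) * 2 + (1 + i * 6)) ≡ 2 * (4 + i * 5)
  rearrange = solve-∀

cubicCycle-bound : ∀ i → 2 * (4 * suc i ∸ 1) ≤ (3 + i * 2) * 3 → i ≤ 1
cubicCycle-bound 0 _ = z≤n
cubicCycle-bound 1 _ = s≤s z≤n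
cubicCycle-bound (suc (suc k)) bound = ⊥-elim (<⇒≱ too-many bound)
  where
  open ≤-Reasoning
  rearrange : ∀ k → suc ((3 + (2 + k) * 2) * 3 + k * 2) ≡ 2 * (3 + (2 + k) * 4)
  rearrange = solve-∀
  too-many : (3 + (2 + k) * 2) * 3 < 2 * (4 * (3 + k) ∸ 1)
  too-many = begin-strict
    (3 + (2 + k) * 2) * 3                <⟨ s≤s (m≤m+n _ (k * 2)) ⟩
    suc ((3 + (2 + k) * 2) * 3 + k * 2)  ≡⟨ rearrange k ⟩
    2 * (3 + (2 + k) * 4)                ≡⟨ cong (2 *_) (*-suc∸1 3 (2 + k)) ⟨
    2 * (4 * (3 + k) ∸ 1)                ∎

1≤length-++ : ∀ {A : Set} (xs : List A) {ys} → 1 ≤ length ys → 1 ≤ length (xs ++ ys)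
1≤length-++ [] 1≤ys = 1≤ys
1≤length-++ (_ ∷ _) _ = s≤s z≤n

hit-before-last : ∀ {A : Set} (p : A → Bool) M → 2 ≤ sum (map (b2n ∘ p) M) →
                  ∃[ N₁ ] ∃[ w ] ∃[ y ] ∃[ N₂ ] M ≡ N₁ ++ w ∷ y ∷ N₂ × p w ≡ true
hit-before-last p [] ()
hit-before-last p (w ∷ M) 2≤ with p w in pw
... | true with M | 2≤
...   | y ∷ N₂ | _ = [] , w , y , N₂ , refl , pw
...   | [] | s≤s ()
hit-before-last p (w ∷ M) 2≤ | false with hit-before-last p M 2≤
...   | N₁ , w′ , y , N₂ , eq , pw′ = w ∷ N₁ , w′ , y , N₂ , cong (w ∷_) eq , pw′

interior-hit : ∀ {A : Set} (p : A → Bool) M → 3 ≤ sum (map (b2n ∘ p) M) →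
               ∃[ x ] ∃[ N₁ ] ∃[ w ] ∃[ y ] ∃[ N₂ ] M ≡ x ∷ N₁ ++ w ∷ y ∷ N₂ × p w ≡ true
interior-hit p (x ∷ M) 3≤ with hit-before-last p M (s≤s⁻¹ (≤-trans 3≤ (+-monoˡ-≤ _ (b2n≤1 (p x)))))
... | N₁ , w , y , N₂ , refl , pw = x , N₁ , w , y , N₂ , refl , pw

module _ {A : Set} (_≟ᴬ_ : DecidableEquality A) where
  open import Data.List.Membership.DecPropositional _≟ᴬ_ using (_∈?_)

  unique⊎duplicate : ∀ (l : List A) → Unique l ⊎ ∃[ B ] ∃[ v ] ∃[ C ] ∃[ D ] l ≡ B ++ v ∷ C ++ v ∷ D
  unique⊎duplicate [] = inj₁ []
  unique⊎duplicate (x ∷ l) with x ∈? l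
  ... | yes x∈l with ∈-∃++ x∈l
  ...   | C , D , refl = inj₂ ([] , x , C , D , refl)
  unique⊎duplicate (x ∷ l) | no x∉l with unique⊎duplicate l
  ...   | inj₁ l-unique = inj₁ (¬Any⇒All¬ l x∉l ∷ l-unique)
  ...   | inj₂ (B , v , C , D , refl) = inj₂ (x ∷ B , v , C , D , refl)

-- The pentagon with two chords

module Pentagon where

  open import Data.Bool.Properties using () renaming (_≟_ to _≟ᵇ_)
  open import Data.Fin.Properties using (all?; any?; toℕ<n)
  open import Data.Nat using () renaming (_≟_ to _≟ⁿ_)
  open import Function.Bundles using (_↔_; mk↔ₛ′)
  open import Relation.Nullary using (Dec)
  open import Relation.Nullary.Decidable using (map′; _×-dec_; _→-dec_; toWitness)
  open import Relation.Unary using (Decidable)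

  pattern v0 = zero
  pattern v1 = suc zero
  pattern v2 = suc (suc zero)
  pattern v3 = suc (suc (suc zero))
  pattern v4 = suc (suc (suc (suc zero)))

  next : Fin 5 → Fin 5
  next v0 = v1
  next v1 = v2
  next v2 = v3
  next v3 = v4
  next v4 = v0

  rotate : ℕ → Fin 5 → Fin 5
  rotate zero = id
  rotate (suc k) = next ∘ rotate k

  rotate-+ : ∀ a b i → rotate a (rotate b i) ≡ rotate (a + b) i
  rotate-+ zero b i = refl
  rotate-+ (suc a) b i = cong next (rotate-+ a b i)

  rotate-5 : ∀ i → rotate 5 i ≡ i
  rotate-5 v0 = refl
  rotate-5 v1 = refl
  rotate-5 v2 = refl
  rotate-5 v3 = refl
  rotate-5 v4 = refl

  rotation : ∀ k → k ≤ 5 → Fin 5 ↔ Fin 5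
  rotation k k≤5 =
    mk↔ₛ′ (rotate k) (rotate (5 ∸ k)) (cancel k (5 ∸ k) (m+[n∸m]≡n k≤5)) (cancel (5 ∸ k) k (m∸n+n≡m k≤5))
    where
    cancel : ∀ a b → a + b ≡ 5 → ∀ i → rotate a (rotate b i) ≡ i
    cancel a b a+b≡5 i = trans (rotate-+ a b i) (trans (cong (λ k → rotate k i) a+b≡5) (rotate-5 i))

  rowSum : (Fin 5 → Fin 5 → Bool) → Fin 5 → ℕ
  rowSum A i = ∑[ j < 5 ] b2n (A i j)

  withChords : Bool → Bool → Bool → Bool → Bool → Fin 5 → Fin 5 → Bool
  withChords c02 c03 c13 c14 c24 = λ where
    v0 v0 → false ; v0 v1 → true  ; v0 v2 → c02   ; v0 v3 → c03   ; v0 v4 → true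
    v1 v0 → true  ; v1 v1 → false ; v1 v2 → true  ; v1 v3 → c13   ; v1 v4 → c14
    v2 v0 → c02   ; v2 v1 → true  ; v2 v2 → false ; v2 v3 → true  ; v2 v4 → c24
    v3 v0 → c03   ; v3 v1 → c13   ; v3 v2 → true  ; v3 v3 → false ; v3 v4 → true
    v4 v0 → true  ; v4 v1 → c14   ; v4 v2 → c24   ; v4 v3 → true  ; v4 v4 → false

  IsRotationOf : (Fin 5 → Fin 5 → Bool) → (Fin 5 → Fin 5 → Bool) → Fin 5 → Set
  IsRotationOf A B k = ∀ i j → A i j ≡ B (rotate (toℕ k) i) (rotate (toℕ k) j)

  ∀-Bool? : ∀ {P : Bool → Set} → Decidable P → Dec (∀ b → P b)
  ∀-Bool? P? = map′ (λ (t , f) → λ { true → t ; false → f }) (λ h → h true , h false) (P? true ×-dec P? false)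

  -- Decided by evaluation over all 2⁵ chord sets.
  classify : ∀ c02 c03 c13 c14 c24 → let A = withChords c02 c03 c13 c14 c24 in
             ∑[ i < 5 ] rowSum A i ≡ 14 → (∀ i → rowSum A i ≤ 3) → ∃ (IsRotationOf A C5'adj)
  classify = toWitness {a? = ∀-Bool? λ c02 → ∀-Bool? λ c03 → ∀-Bool? λ c13 → ∀-Bool? λ c14 → ∀-Bool? λ c24 →
    let A = withChords c02 c03 c13 c14 c24 in
    (∑[ i < 5 ] rowSum A i ≟ⁿ 14) →-dec all? (λ i → rowSum A i ≤? 3) →-dec
    any? (λ k → all? λ i → all? λ j → A i j ≟ᵇ C5'adj (rotate (toℕ k) i) (rotate (toℕ k) j))} _

  module _ (A : Fin 5 → Fin 5 → Bool) (A-sym : ∀ i j → A i j ≡ A j i) (A-irrefl : ∀ i → A i i ≡ false)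
           (e01 : A v0 v1 ≡ true) (e12 : A v1 v2 ≡ true) (e23 : A v2 v3 ≡ true)
           (e34 : A v3 v4 ≡ true) (e40 : A v4 v0 ≡ true) where

    private
      Aᶜ : Fin 5 → Fin 5 → Bool
      Aᶜ = withChords (A v0 v2) (A v0 v3) (A v1 v3) (A v1 v4) (A v2 v4)

      chordForm : ∀ i j → A i j ≡ Aᶜ i j
      chordForm v0 v0 = A-irrefl v0
      chordForm v0 v1 = e01
      chordForm v0 v2 = refl
      chordForm v0 v3 = refl
      chordForm v0 v4 = trans (A-sym v0 v4) e40
      chordForm v1 v0 = trans (A-sym v1 v0) e01
      chordForm v1 v1 = A-irrefl v1
      chordForm v1 v2 = e12
      chordForm v1 v3 = refl
      chordForm v1 v4 = refl
      chordForm v2 v0 = A-sym v2 v0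
      chordForm v2 v1 = trans (A-sym v2 v1) e12
      chordForm v2 v2 = A-irrefl v2
      chordForm v2 v3 = e23
      chordForm v2 v4 = refl
      chordForm v3 v0 = A-sym v3 v0
      chordForm v3 v1 = A-sym v3 v1
      chordForm v3 v2 = trans (A-sym v3 v2) e23
      chordForm v3 v3 = A-irrefl v3
      chordForm v3 v4 = e34
      chordForm v4 v0 = e40
      chordForm v4 v1 = A-sym v4 v1
      chordForm v4 v2 = A-sym v4 v2
      chordForm v4 v3 = trans (A-sym v4 v3) e34
      chordForm v4 v4 = A-irrefl v4

      rowSum-chordForm : ∀ i → rowSum A i ≡ rowSum Aᶜ i
      rowSum-chordForm i = sum-cong-≗ {5} (λ j → cong b2n (chordForm i j))

    pentagon : ∑[ i < 5 ] rowSum A i ≡ 14 → (∀ i → rowSum A i ≤ 3) → Isomorphic A C5'adj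
    pentagon total rows = rotation (toℕ k) (<⇒≤ (toℕ<n k)) , λ i j → trans (chordForm i j) (rotated i j)
      where
      classified : ∃ (IsRotationOf Aᶜ C5'adj)
      classified = classify (A v0 v2) (A v0 v3) (A v1 v3) (A v1 v4) (A v2 v4)
                     (trans (sym (sum-cong-≗ {5} rowSum-chordForm)) total)
                     (λ i → subst (_≤ 3) (rowSum-chordForm i) (rows i))
      k = proj₁ classified
      rotated = proj₂ classified

open Pentagon using (pentagon; v0; v1; v2; v3)

module _ {n : ℕ} (G : Graph n) where

  open import Data.List.Membership.DecPropositional (_≟_ {n}) using (_∈?_)

  Adj-sym : ∀ {x y} → Adj G x y ≡ true → Adj G y x ≡ true
  Adj-sym {x} {y} = trans (Graph.sym G y x)

  Adj-irrefl : ∀ {x} → Adj G x x ≢ true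
  Adj-irrefl {x} e with trans (sym (irrefl G x)) e
  ... | ()

  infixr 5 _∷_ _++ʷ_

  -- Walk x l y: a walk from x to y visiting the entries of l in order after x, so that it
  -- has length l edges.
  data Walk : Fin n → List (Fin n) → Fin n → Set where
    []  : ∀ {x} → Walk x [] x
    _∷_ : ∀ {x y l z} → Adj G x y ≡ true → Walk y l z → Walk x (y ∷ l) z

  _++ʷ_ : ∀ {x y z A B} → Walk x A y → Walk y B z → Walk x (A ++ B) z
  [] ++ʷ q = q
  (e ∷ p) ++ʷ q = e ∷ (p ++ʷ q)

  Walk-++⁻ : ∀ A {x z B} → Walk x (A ++ B) z → ∃ λ y → Walk x A y × Walk y B z
  Walk-++⁻ [] p = _ , [] , p
  Walk-++⁻ (a ∷ A) (e ∷ p) with Walk-++⁻ A p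
  ... | y , p₁ , p₂ = y , e ∷ p₁ , p₂

  Walk-splitAt : ∀ A {x w z B} → Walk x (A ++ w ∷ B) z → Walk x (A ++ [ w ]) w × Walk w B z
  Walk-splitAt [] (e ∷ p) = e ∷ [] , p
  Walk-splitAt (a ∷ A) (e ∷ p) with Walk-splitAt A p
  ... | p₁ , p₂ = e ∷ p₁ , p₂

  Walk-reverse : ∀ {x y A} → Walk x A y → ∃ λ B → Walk y B x × length B ≡ length A
  Walk-reverse [] = [] , [] , refl
  Walk-reverse {x} (e ∷ p) with Walk-reverse p
  ... | B , q , |B|≡ = B ++ [ x ] , q ++ʷ (Adj-sym e ∷ []) ,
                      trans (length-++ B) (trans (+-comm _ 1) (cong suc |B|≡))

  Closed : List (Fin n) → Set
  Closed l = ∃ λ x → Walk x l x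

  oddClosed⇒3≤length : ∀ {l} → Closed l → odd? (length l) ≡ true → 3 ≤ length l
  oddClosed⇒3≤length {[]} _ ()
  oddClosed⇒3≤length {_ ∷ []} (_ , e ∷ []) _ = ⊥-elim (Adj-irrefl e)
  oddClosed⇒3≤length {_ ∷ _ ∷ []} _ ()
  oddClosed⇒3≤length {_ ∷ _ ∷ _ ∷ _} _ _ = s≤s (s≤s (s≤s z≤n))

  setOf : List (Fin n) → VSet n
  setOf l v = does (v ∈? l)

  ∈⇒setOf : ∀ {l v} → v ∈ l → setOf l v ≡ true
  ∈⇒setOf {l} {v} = dec-true (v ∈? l)

  setOf⇒∈ : ∀ {l v} → setOf l v ≡ true → v ∈ l
  setOf⇒∈ {l} {v} s with v ∈? l
  ... | yes v∈l = v∈l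

  ∑-setOf : ∀ {l} → Unique l → (f : Fin n → ℕ) → ∑[ w < n ] (b2n (setOf l w) * f w) ≡ sum (map f l)
  ∑-setOf {[]} _ f = sum-replicate-zero n
  ∑-setOf {x ∷ l} x∷l-unique@(_ ∷ l-unique) f = begin
      ∑[ w < n ] (b2n (does (w ≟ x) ∨ setOf l w) * f w)
    ≡⟨ sum-cong-≗ {n} split ⟩
      ∑[ w < n ] (b2n (does (w ≟ x)) * f w + b2n (setOf l w) * f w)
    ≡⟨ ∑-distrib-+ (λ w → b2n (does (w ≟ x)) * f w) (λ w → b2n (setOf l w) * f w) ⟩
      ∑[ w < n ] (b2n (does (w ≟ x)) * f w) + ∑[ w < n ] (b2n (setOf l w) * f w)
    ≡⟨ cong₂ _+_ (∑-indicator x f) (∑-setOf l-unique f) ⟩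
      f x + sum (map f l) ∎
    where
    open ≡-Reasoning
    split : ∀ w → b2n (does (w ≟ x) ∨ setOf l w) * f w ≡ b2n (does (w ≟ x)) * f w + b2n (setOf l w) * f w
    split w with w ≟ x
    ... | yes refl rewrite dec-false (x ∈? l) (Unique[x∷xs]⇒x∉xs x∷l-unique) = sym (+-identityʳ _)
    ... | no _ = refl

  ∣setOf∣ : ∀ {l} → Unique l → ∣ setOf l ∣ˢ ≡ length l
  ∣setOf∣ {l} u = begin
      ∣ setOf l ∣ˢ                         ≡⟨ sum-allFin (λ w → b2n (setOf l w)) ⟩
      ∑[ w < n ] b2n (setOf l w)           ≡⟨ sum-cong-≗ {n} (λ w → sym (*-identityʳ _)) ⟩
      ∑[ w < n ] (b2n (setOf l w) * 1)     ≡⟨ ∑-setOf u (λ _ → 1) ⟩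
      sum (map (λ _ → 1) l)                ≡⟨ sum-ones l ⟩
      length l                             ∎
    where
    open ≡-Reasoning
    sum-ones : ∀ xs → sum (map (λ _ → 1) xs) ≡ length xs
    sum-ones [] = refl
    sum-ones (_ ∷ xs) = cong suc (sum-ones xs)

  degIn : List (Fin n) → Fin n → ℕ
  degIn l x = sum (map (λ y → b2n (Adj G x y)) l)

  degIn≤deg : ∀ {l} → Unique l → ∀ x → degIn l x ≤ deg G x
  degIn≤deg {l} u x = begin
      degIn l x                                        ≡⟨ ∑-setOf u (λ w → b2n (Adj G x w)) ⟨
      ∑[ w < n ] (b2n (setOf l w) * b2n (Adj G x w))   ≤⟨ ∑-mono-≤ (λ w → indicator≤ (setOf l w) _) ⟩
      ∑[ w < n ] b2n (Adj G x w)                       ≡⟨ sum-allFin (λ w → b2n (Adj G x w)) ⟨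
      deg G x                                          ∎
    where
    open ≤-Reasoning
    indicator≤ : ∀ b c → b2n b * c ≤ c
    indicator≤ true c = ≤-reflexive (+-identityʳ c)
    indicator≤ false c = z≤n

  ordered-pair : ∀ (S : VSet n) u v →
    b2n (S u ∧ S v ∧ Adj G u v ∧ (toℕ u <ᵇ toℕ v)) + b2n (S v ∧ S u ∧ Adj G v u ∧ (toℕ v <ᵇ toℕ u))
      ≡ b2n (S u ∧ S v ∧ Adj G u v)
  ordered-pair S u v with u ≟ v
  ... | yes refl rewrite irrefl G u with S u
  ...   | true = refl
  ...   | false = refl
  ordered-pair S u v | no u≢v rewrite Graph.sym G v u with S u | S v | Adj G u v
  ... | false | false | _     = refl
  ... | false | true  | _     = refl
  ... | true  | false | _     = refl
  ... | true  | true  | false = refl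
  ... | true  | true  | true  = <ᵇ-exclusive (u≢v ∘ toℕ-injective)

  edgesIn-double : ∀ S → 2 * edgesIn G S ≡ ∑[ u < n ] ∑[ v < n ] b2n (S u ∧ S v ∧ Adj G u v)
  edgesIn-double S = begin
      2 * edgesIn G S                                ≡⟨ cong (2 *_) edgesIn≡E ⟩
      E + (E + 0)                                    ≡⟨ cong (E +_) (+-identityʳ E) ⟩
      E + E                                          ≡⟨ cong (E +_) (∑-comm e) ⟩
      E + ∑[ u < n ] ∑[ v < n ] e v u                ≡⟨ ∑-distrib-+ (λ u → ∑ (e u)) (λ u → ∑[ v < n ] e v u) ⟨
      ∑[ u < n ] (∑[ v < n ] e u v + ∑[ v < n ] e v u) ≡⟨ sum-cong-≗ {n} (λ u → ∑-distrib-+ (e u) (λ v → e v u)) ⟨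
      ∑[ u < n ] ∑[ v < n ] (e u v + e v u)          ≡⟨ sum-cong-≗ {n} (λ u → sum-cong-≗ {n} (ordered-pair S u)) ⟩
      ∑[ u < n ] ∑[ v < n ] b2n (S u ∧ S v ∧ Adj G u v) ∎
    where
    open ≡-Reasoning
    e : Fin n → Fin n → ℕ
    e u v = b2n (S u ∧ S v ∧ Adj G u v ∧ (toℕ u <ᵇ toℕ v))
    E = ∑[ u < n ] ∑[ v < n ] e u v
    edgesIn≡E : edgesIn G S ≡ E
    edgesIn≡E = trans (sum-allFin (λ u → sum (map (e u) (allFin n)))) (sum-cong-≗ {n} (λ u → sum-allFin (e u)))

  handshake : ∀ {l} → Unique l → 2 * edgesIn G (setOf l) ≡ sum (map (degIn l) l)
  handshake {l} u = begin
      2 * edgesIn G S                                              ≡⟨ edgesIn-double S ⟩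
      ∑[ x < n ] ∑[ y < n ] b2n (S x ∧ S y ∧ Adj G x y)            ≡⟨ sum-cong-≗ {n} (λ x → sum-cong-≗ {n} (λ y →
                                                                        trans (b2n-∧ (S x) _) (cong (b2n (S x) *_) (b2n-∧ (S y) _)))) ⟩
      ∑[ x < n ] ∑[ y < n ] (b2n (S x) * (b2n (S y) * b2n (Adj G x y))) ≡⟨ sum-cong-≗ {n} (λ x → *-distribˡ-sum (b2n (S x)) (λ y → b2n (S y) * b2n (Adj G x y))) ⟨
      ∑[ x < n ] (b2n (S x) * ∑[ y < n ] (b2n (S y) * b2n (Adj G x y))) ≡⟨ sum-cong-≗ {n} (λ x → cong (b2n (S x) *_) (∑-setOf u (λ y → b2n (Adj G x y)))) ⟩
      ∑[ x < n ] (b2n (S x) * degIn l x)                           ≡⟨ ∑-setOf u (degIn l) ⟩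
      sum (map (degIn l) l)                                        ∎
    where
    open ≡-Reasoning
    S = setOf l

  -- Cycles induce 2-connected factor-critical subgraphs

  Reach-trans : ∀ {S x y z} → Reach G S x y → Reach G S y z → Reach G S x z
  Reach-trans (here _) r = r
  Reach-trans (step sx e r) r′ = step sx e (Reach-trans r r′)

  Reach-mono : ∀ {S T x y} → (∀ {z} → S z ≡ true → T z ≡ true) → Reach G S x y → Reach G T x y
  Reach-mono S⊆T (here sx) = here (S⊆T sx)
  Reach-mono S⊆T (step sx e r) = step (S⊆T sx) e (Reach-mono S⊆T r)

  ConnectedOn-resp : ∀ {S T} → S ≗ T → ConnectedOn G S → ConnectedOn G T
  ConnectedOn-resp S≗T conn x y tx ty =
    Reach-mono (λ {z} sz → trans (sym (S≗T z)) sz) (conn x y (trans (S≗T x) tx) (trans (S≗T y) ty))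

  reach-along : ∀ {S m M b} → (∀ {z} → z ∈ m ∷ M → S z ≡ true) → Walk m M b →
                ∀ {z} → z ∈ m ∷ M → Reach G S m z × Reach G S z m
  reach-along inS _ (here refl) = here (inS (here refl)) , here (inS (here refl))
  reach-along inS (e ∷ p) (there z∈M) with reach-along (inS ∘ there) p z∈M
  ... | m′⇝z , z⇝m′ = step (inS (here refl)) e m′⇝z ,
                      Reach-trans z⇝m′ (step (inS (there (here refl))) (Adj-sym e) (here (inS (here refl))))

  walk-connected : ∀ {a M b} → Walk a M b → ConnectedOn G (setOf M)
  walk-connected [] _ _ () _
  walk-connected (_ ∷ p) x y sx sy =
    Reach-trans (proj₂ (reach-along ∈⇒setOf p (setOf⇒∈ sx))) (proj₁ (reach-along ∈⇒setOf p (setOf⇒∈ sy)))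

  HasPerfectMatchingOn-resp : ∀ {S T} → S ≗ T → HasPerfectMatchingOn G S → HasPerfectMatchingOn G T
  HasPerfectMatchingOn-resp S≗T (m , match) = m , λ v tv →
    let (smv , adj , inv) = match v (trans (S≗T v) tv) in trans (sym (S≗T (m v))) smv , adj , inv

  partner : List (Fin n) → Fin n → Fin n
  partner (x ∷ y ∷ l) v = if does (v ≟ x) then y else if does (v ≟ y) then x else partner l v
  partner _ v = v

  partner-first : ∀ x y l → partner (x ∷ y ∷ l) x ≡ y
  partner-first x y l rewrite dec-true (x ≟ x) refl = refl

  partner-second : ∀ {x y} l → x ≢ y → partner (x ∷ y ∷ l) y ≡ x
  partner-second {x} {y} l x≢y rewrite dec-false (y ≟ x) (x≢y ∘ sym) | dec-true (y ≟ y) refl = refl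

  partner-rest : ∀ {x y v} l → v ≢ x → v ≢ y → partner (x ∷ y ∷ l) v ≡ partner l v
  partner-rest {x} {y} {v} l v≢x v≢y rewrite dec-false (v ≟ x) v≢x | dec-false (v ≟ y) v≢y = refl

  partner-matches : ∀ {a M b} → Walk a M b → Unique M → odd? (length M) ≡ false → ∀ {v} → v ∈ M →
                    partner M v ∈ M × Adj G v (partner M v) ≡ true × partner M (partner M v) ≡ v
  partner-matches [] _ _ ()
  partner-matches (_ ∷ []) _ () _
  partner-matches {M = x ∷ y ∷ M} (_ ∷ e ∷ p) x∷y∷M-unique@(_ ∷ y∷M-unique@(_ ∷ M-unique)) even = matches
    where
    x∉y∷M = Unique[x∷xs]⇒x∉xs x∷y∷M-unique
    y∉M = Unique[x∷xs]⇒x∉xs y∷M-unique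
    x≢y : x ≢ y
    x≢y x≡y = x∉y∷M (here x≡y)
    ≢x : ∀ {w} → w ∈ M → w ≢ x
    ≢x w∈M refl = x∉y∷M (there w∈M)
    ≢y : ∀ {w} → w ∈ M → w ≢ y
    ≢y w∈M refl = y∉M w∈M
    matches : ∀ {v} → v ∈ x ∷ y ∷ M → let w = partner (x ∷ y ∷ M) v in
              w ∈ x ∷ y ∷ M × Adj G v w ≡ true × partner (x ∷ y ∷ M) w ≡ v
    matches (here refl) rewrite partner-first x y M | partner-second M x≢y = there (here refl) , e , refl
    matches (there (here refl)) rewrite partner-second M x≢y | partner-first x y M = here refl , Adj-sym e , refl
    matches (there (there v∈M)) with partner-matches p M-unique (trans (sym (odd?-+2 (length M))) even) v∈M
    ... | w∈M , adj , inv rewrite partner-rest M (≢x v∈M) (≢y v∈M) | partner-rest M (≢x w∈M) (≢y w∈M) =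
      there (there w∈M) , adj , inv

  walk-perfectMatching : ∀ {a M b} → Walk a M b → Unique M → odd? (length M) ≡ false →
                         HasPerfectMatchingOn G (setOf M)
  walk-perfectMatching {M = M} p u even = partner M , λ v sv →
    let (w∈M , adj , inv) = partner-matches p u even (setOf⇒∈ sv) in ∈⇒setOf w∈M , adj , inv

  record Rooted (l : List (Fin n)) (u : Fin n) : Set where
    field
      rest : List (Fin n)
      walk : Walk u (rest ++ [ u ]) u
      perm : l ↭ u ∷ rest

  root : ∀ {l u} → Closed l → u ∈ l → Rooted l u
  root {u = u} (_ , w) u∈l with ∈-∃++ u∈l
  ... | A , B , refl with Walk-splitAt A w
  ... | to-u , from-u = record
    { rest = B ++ A
    ; walk = subst (λ L → Walk u L u) (sym (++-assoc B A [ u ])) (from-u ++ʷ to-u)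
    ; perm = ↭-trans (shift u A B) (prep u (++-comm A B))
    }

  module _ {l u} (l-unique : Unique l) (R : Rooted l u) where
    open Rooted R

    private
      u∷rest-unique : Unique (u ∷ rest)
      u∷rest-unique = PermutationSetoid.Unique-resp-↭ (setoid (Fin n)) (↭⇒↭ₛ perm) l-unique

    rest-unique : Unique rest
    rest-unique with u∷rest-unique
    ... | _ ∷ r = r

    setOf-rest : setOf l -ᵛ u ≗ setOf rest
    setOf-rest v with v ≟ u
    ... | yes refl = sym (dec-false (v ∈? rest) (Unique[x∷xs]⇒x∉xs u∷rest-unique))
    ... | no v≢u with v ∈? rest
    ...   | yes v∈rest = dec-true (v ∈? l) (∈-resp-↭ (↭-sym perm) (there v∈rest))
    ...   | no v∉rest = dec-false (v ∈? l) λ v∈l → case (∈-resp-↭ perm v∈l)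
      where
      case : v ∈ u ∷ rest → ⊥
      case (here v≡u) = v≢u v≡u
      case (there v∈rest) = v∉rest v∈rest

  cycle-twoConnected : ∀ {l} → Closed l → Unique l → 3 ≤ length l → TwoConnectedOn G (setOf l)
  cycle-twoConnected c@(_ , w) u 3≤len =
      subst (3 ≤_) (sym (∣setOf∣ u)) 3≤len
    , walk-connected w
    , λ v sv → let R = root c (setOf⇒∈ sv)
                   (_ , prefix , _) = Walk-++⁻ (Rooted.rest R) (Rooted.walk R)
               in ConnectedOn-resp (sym ∘ setOf-rest u R) (walk-connected prefix)

  cycle-factorCritical : ∀ {l} → Closed l → Unique l → odd? (length l) ≡ true → FactorCriticalOn G (setOf l)
  cycle-factorCritical c u odd v sv =
    HasPerfectMatchingOn-resp (sym ∘ setOf-rest u R) (walk-perfectMatching prefix (rest-unique u R) even)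
    where
    R = root c (setOf⇒∈ sv)
    open Rooted R
    prefix = proj₁ (proj₂ (Walk-++⁻ rest walk))
    even : odd? (length rest) ≡ false
    even with odd? (length rest) | trans (cong odd? (sym (↭-length perm))) odd
    ... | false | _ = refl
    ... | true | ()

  CriticalEdgeCount : ℕ → Set
  CriticalEdgeCount δ = ∀ (S : VSet n) → TwoConnectedOn G S → FactorCriticalOn G S
                        → edgesIn G S ≡ (δ + 1) * ((∣ S ∣ˢ ∸ 1) / 2) ∸ 1

  oddCycle-edges : ∀ {δ l} → CriticalEdgeCount δ → Closed l → Unique l → odd? (length l) ≡ true →
                   ∃ λ i → length l ≡ 3 + i * 2 × edgesIn G (setOf l) ≡ (δ + 1) * suc i ∸ 1
  oddCycle-edges {δ} {l} count c u odd with odd?⇒≡1+2j (length l) odd | oddClosed⇒3≤length c odd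
  ... | suc i , len≡ | 3≤len = i , len≡ , (begin
      edgesIn G (setOf l)                     ≡⟨ count (setOf l) (cycle-twoConnected c u 3≤len) (cycle-factorCritical c u odd) ⟩
      (δ + 1) * ((∣ setOf l ∣ˢ ∸ 1) / 2) ∸ 1  ≡⟨ cong (λ k → (δ + 1) * ((k ∸ 1) / 2) ∸ 1) (trans (∣setOf∣ u) len≡) ⟩
      (δ + 1) * ((suc i * 2) / 2) ∸ 1         ≡⟨ cong (λ k → (δ + 1) * k ∸ 1) (m*n/n≡m (suc i) 2) ⟩
      (δ + 1) * suc i ∸ 1                     ∎)
    where open ≡-Reasoning
  ... | zero , len≡ | 3≤len with s≤s () ← subst (3 ≤_) len≡ 3≤len

  -- Odd closed walks when δ ≥ 4

  ShorterOddClosedWalk : ℕ → Set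
  ShorterOddClosedWalk L = ∃ λ l → Closed l × odd? (length l) ≡ true × length l < L

  shorter-of-pieces : ∀ {l₁ l₂ L} → Closed l₁ → Closed l₂ → length l₁ < L → length l₂ < L →
                      odd? (length l₁ + length l₂) ≡ true → ShorterOddClosedWalk L
  shorter-of-pieces {l₁} {l₂} c₁ c₂ lt₁ lt₂ odd with odd?-summand (length l₁) (length l₂) odd
  ... | inj₁ odd₁ = l₁ , c₁ , odd₁ , lt₁
  ... | inj₂ odd₂ = l₂ , c₂ , odd₂ , lt₂

  duplicate⇒shorter : ∀ A v B C → let l = A ++ v ∷ B ++ v ∷ C in
                      Closed l → odd? (length l) ≡ true → ShorterOddClosedWalk (length l)
  duplicate⇒shorter A v B C (_ , w) odd with Walk-splitAt A w
  ... | to-v , from-v with Walk-splitAt B from-v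
  ... | loop , back =
    shorter-of-pieces (v , loop) (v , back ++ʷ to-v) lt₁ lt₂ (subst (λ k → odd? k ≡ true) (sym total) odd)
    where
    total : length (B ++ [ v ]) + length (C ++ A ++ [ v ]) ≡ length (A ++ v ∷ B ++ v ∷ C)
    total = begin
      length (B ++ [ v ]) + length (C ++ A ++ [ v ])  ≡⟨ cong₂ _+_ (length-++ B) (trans (length-++ C) (cong (length C +_) (length-++ A))) ⟩
      length B + 1 + (length C + (length A + 1))      ≡⟨ rearrange (length A) (length B) (length C) ⟩
      length A + suc (length B + suc (length C))      ≡⟨ trans (length-++ A) (cong (λ k → length A + suc k) (length-++ B)) ⟨
      length (A ++ v ∷ B ++ v ∷ C)                    ∎
      where
      open ≡-Reasoning
      rearrange : ∀ a b c → b + 1 + (c + (a + 1)) ≡ a + suc (b + suc c)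
      rearrange = solve-∀
    lt = summands< (1≤length-++ B (s≤s z≤n)) (1≤length-++ C (1≤length-++ A (s≤s z≤n))) total
    lt₁ = proj₁ lt
    lt₂ = proj₂ lt

  degIn-rooted : ∀ {l u} → (R : Rooted l u) → degIn l u ≡ degIn (Rooted.rest R) u
  degIn-rooted {l} {u} R = begin
    degIn l u                          ≡⟨ sum-↭ (map⁺ _ (Rooted.perm R)) ⟩
    b2n (Adj G u u) + degIn rest u     ≡⟨ cong (λ b → b2n b + degIn rest u) (irrefl G u) ⟩
    degIn rest u                       ∎
    where
    open ≡-Reasoning
    rest = Rooted.rest R

  -- The interior neighbour w of v gives a chord vw, which splits the cycle into two closed walks
  -- whose lengths add up to length l + 2.
  chord⇒shorter : ∀ {l v} → Rooted l v → 3 ≤ degIn l v → odd? (length l) ≡ true → ShorterOddClosedWalk (length l)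
  chord⇒shorter {l} {v} R@record { rest = M ; walk = walk ; perm = perm } 3≤deg odd
    with interior-hit (Adj G v) M (subst (3 ≤_) (degIn-rooted R) 3≤deg)
  ... | x , N₁ , w , y , N₂ , refl , vw
    with Walk-splitAt (x ∷ N₁) (subst (λ L → Walk v L v) (cong (x ∷_) (++-assoc N₁ (w ∷ y ∷ N₂) [ v ])) walk)
  ... | X-walk , Y-walk =
    shorter-of-pieces (w , Adj-sym vw ∷ X-walk) (v , vw ∷ Y-walk) (proj₁ lt) (proj₂ lt)
      (trans (odd?-suc+suc (length X) (length Y)) (subst (λ k → odd? k ≡ true) (sym |X|+|Y|) odd))
    where
    X = x ∷ N₁ ++ [ w ]
    Y = y ∷ N₂ ++ [ v ]
    |X|+|Y| : length X + length Y ≡ length l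
    |X|+|Y| = begin
      length X + length Y                     ≡⟨ cong₂ (λ a b → suc a + suc b) (length-++ N₁) (length-++ N₂) ⟩
      suc (length N₁ + 1) + suc (length N₂ + 1) ≡⟨ rearrange (length N₁) (length N₂) ⟩
      suc (suc (length N₁ + suc (suc (length N₂)))) ≡⟨ cong (λ k → 2 + k) (length-++ N₁) ⟨
      suc (length (x ∷ N₁ ++ w ∷ y ∷ N₂))       ≡⟨ ↭-length perm ⟨
      length l                                 ∎
      where
      open ≡-Reasoning
      rearrange : ∀ a b → suc (a + 1) + suc (b + 1) ≡ suc (suc (a + suc (suc b)))
      rearrange = solve-∀
    lt = suc-summands< (s≤s (1≤length-++ N₁ (s≤s z≤n))) (s≤s (1≤length-++ N₂ (s≤s z≤n))) |X|+|Y|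

  ¬chordlessOddCycle : ∀ {δ l} → 4 ≤ δ → CriticalEdgeCount δ → Closed l → Unique l → odd? (length l) ≡ true →
                       All (λ v → degIn l v ≤ 2) l → ⊥
  ¬chordlessOddCycle {δ} δ≥4 count c u odd low with oddCycle-edges {δ} count c u odd
  ... | i , len≡ , edges≡ = <⇒≱ (cycleDegreeSum<criticalEdges δ i δ≥4)
    (subst₂ _≤_ (trans (sym (handshake u)) (cong (2 *_) edges≡)) (cong (_* 2) len≡) (sum-map-≤ low))

  oddClosedWalk-shrinks : ∀ {δ} → 4 ≤ δ → CriticalEdgeCount δ → ∀ {l} → Closed l → odd? (length l) ≡ true →
                          ShorterOddClosedWalk (length l)
  oddClosedWalk-shrinks δ≥4 count {l} c odd with unique⊎duplicate _≟_ l
  ... | inj₂ (A , v , B , C , refl) = duplicate⇒shorter A v B C c odd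
  ... | inj₁ u with All.all? (λ v → degIn l v ≤? 2) l
  ...   | yes low = ⊥-elim (¬chordlessOddCycle δ≥4 count c u odd low)
  ...   | no high with find (¬All⇒Any¬ (λ v → degIn l v ≤? 2) l high)
  ...     | v , v∈l , deg≰2 = chord⇒shorter (root c v∈l) (≰⇒> deg≰2) odd

  noOddClosedWalk : ∀ {δ} → 4 ≤ δ → CriticalEdgeCount δ → ∀ {l} → Closed l → odd? (length l) ≢ true
  noOddClosedWalk δ≥4 count c = <-rec P descend _ _ refl c
    where
    P : ℕ → Set
    P L = ∀ l → length l ≡ L → Closed l → odd? (length l) ≢ true
    descend : ∀ L → (∀ {K} → K < L → P K) → P L
    descend _ shorter l refl c odd with oddClosedWalk-shrinks δ≥4 count c odd
    ... | l′ , c′ , odd′ , l′<l = shorter l′<l l′ refl c′ odd′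

  Reach⇒Walk : ∀ {S x y} → Reach G S x y → ∃ λ l → Walk x l y
  Reach⇒Walk (here _) = [] , []
  Reach⇒Walk (step _ e r) = let l , w = Reach⇒Walk r in _ ∷ l , e ∷ w

  bipartite-fromRoot : Fin n → Connected G → (∀ {l} → Closed l → odd? (length l) ≢ true) → Bipartite G
  bipartite-fromRoot r conn noOdd = colour , proper
    where
    walkFrom : ∀ v → ∃ λ l → Walk r l v
    walkFrom v = Reach⇒Walk (conn r v refl refl)
    colour : Fin n → Bool
    colour v = odd? (length (proj₁ (walkFrom v)))
    proper : ∀ u v → Adj G u v ≡ true → colour u ≢ colour v
    proper u v e same = noOdd (r , wu ++ʷ (e ∷ wv⁻¹)) odd
      where
      lu = proj₁ (walkFrom u)
      wu = proj₂ (walkFrom u)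
      reversed = Walk-reverse (proj₂ (walkFrom v))
      wv⁻¹ = proj₁ (proj₂ reversed)
      odd : odd? (length (lu ++ v ∷ proj₁ reversed)) ≡ true
      odd = trans (cong odd? (length-++ lu)) (odd?-+suc {length lu} {length (proj₁ reversed)} (trans same (cong odd? (sym (proj₂ (proj₂ reversed))))))

  -- Odd cycles when δ = 3

  maxDegree : ∀ {δ} → 2 ≤ δ → (∀ u → Essential G u → deg G u ≡ δ) → ∀ x → deg G x ≤ δ
  maxDegree 2≤δ essential x with deg G x ≤? 2
  ... | yes deg≤2 = ≤-trans deg≤2 2≤δ
  ... | no deg≰2 = ≤-reflexive (essential x (inj₂ (inj₂ (≰⇒> deg≰2))))

  degreeSum≤ : ∀ {δ l} → 2 ≤ δ → (∀ u → Essential G u → deg G u ≡ δ) → Unique l →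
               sum (map (degIn l) l) ≤ length l * δ
  degreeSum≤ {l = l} 2≤δ essential u = sum-map-≤ {xs = l} (All.tabulate λ {x} _ → ≤-trans (degIn≤deg u x) (maxDegree 2≤δ essential x))

  cubic-oddCycle≤5 : (∀ u → Essential G u → deg G u ≡ 3) → CriticalEdgeCount 3 →
                     ∀ {l} → Closed l → Unique l → odd? (length l) ≡ true → length l ≤ 5
  cubic-oddCycle≤5 essential count c u odd with oddCycle-edges {3} count c u odd
  ... | i , len≡ , edges≡ = subst (_≤ 5) (sym len≡) (+-monoʳ-≤ 3 (*-monoˡ-≤ 2 (cubicCycle-bound i bound)))
    where
    bound = subst₂ _≤_ (trans (sym (handshake u)) (cong (2 *_) edges≡)) (cong (_* 3) len≡)
                   (degreeSum≤ (s≤s (s≤s z≤n)) essential u)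

  tabulate-walk : ∀ m (f : Fin (suc m) → Fin n) → (∀ (i : Fin m) → Adj G (f (inject₁ i)) (f (suc i)) ≡ true) →
                  Walk (f zero) (tabulate (f ∘ suc)) (f (fromℕ m))
  tabulate-walk zero f edges = []
  tabulate-walk (suc m) f edges = edges zero ∷ tabulate-walk m (f ∘ suc) (edges ∘ suc)

  cycle-closed : ∀ {m} (C : Cycle G m) → Closed (tabulate (vtx C))
  cycle-closed {m} C = vtx C (fromℕ m) , close C ∷ tabulate-walk m (vtx C) (edge C)

  cycle-unique : ∀ {m} (C : Cycle G m) → Unique (tabulate (vtx C))
  cycle-unique C = tabulate⁺ (inj C)

  degreeSum-tabulate : ∀ {k} (f : Fin k → Fin n) →
                       sum (map (degIn (tabulate f)) (tabulate f)) ≡ ∑[ i < k ] ∑[ j < k ] b2n (Adj G (f i) (f j))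
  degreeSum-tabulate {k} f = trans (sum-map-tabulate f (degIn (tabulate f)))
                                   (sum-cong-≗ {k} (λ i → sum-map-tabulate f (λ y → b2n (Adj G (f i) y))))

  cubic-Cycle≤5 : (∀ u → Essential G u → deg G u ≡ 3) → CriticalEdgeCount 3 →
                  ∀ m (C : Cycle G m) → Odd (len C) → len C ≤ 5
  cubic-Cycle≤5 essential count m C odd =
    subst (_≤ 5) (length-tabulate (vtx C))
      (cubic-oddCycle≤5 essential count (cycle-closed C) (cycle-unique C)
        (subst (λ k → odd? k ≡ true) (sym (length-tabulate (vtx C))) (Odd⇒odd? odd)))

  cubic-pentagon : (∀ u → Essential G u → deg G u ≡ 3) → CriticalEdgeCount 3 →
                   (C : Cycle G 4) → Isomorphic (inducedOnCycle C) C5'adj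
  cubic-pentagon essential count C with oddCycle-edges {3} count (cycle-closed C) (cycle-unique C) refl
  ... | 1 , _ , edges≡ =
    pentagon (inducedOnCycle C) (λ i j → Graph.sym G (vtx C i) (vtx C j)) (λ i → irrefl G (vtx C i))
      (edge C v0) (edge C v1) (edge C v2) (edge C v3) (close C) total rows
    where
    total = trans (sym (degreeSum-tabulate (vtx C))) (trans (sym (handshake (cycle-unique C))) (cong (2 *_) edges≡))
    rows = λ i → subst (_≤ 3) (sum-map-tabulate (vtx C) (λ y → b2n (Adj G (vtx C i) y)))
                   (≤-trans (degIn≤deg (cycle-unique C) (vtx C i)) (maxDegree (s≤s (s≤s z≤n)) essential (vtx C i)))

noOddClosedWalk⇒bipartite : ∀ {n} (G : Graph n) → Connected G →
                            (∀ {l} → Closed G l → odd? (length l) ≢ true) → Bipartite G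
noOddClosedWalk⇒bipartite {zero} G _ _ = (λ ()) , λ ()
noOddClosedWalk⇒bipartite {suc n} G = bipartite-fromRoot G zero

lemma3p1 : ∀ {n} (G : Graph n) (δ : ℕ) → Connected G → 1 ≤ δ
    → (∀ u → Essential G u → deg G u ≡ δ)
    → (∀ (S : VSet n) → TwoConnectedOn G S → FactorCriticalOn G S
         → edgesIn G S ≡ (δ + 1) * ((∣ S ∣ˢ ∸ 1) / 2) ∸ 1)
    → (δ ≡ 3
         → (∀ m (C : Cycle G m) → Odd (len C) → len C ≤ 5)
         × (∀ (C : Cycle G 4) → Isomorphic (inducedOnCycle C) C5'adj))
      × (4 ≤ δ → Bipartite G)
lemma3p1 G δ connected _ essential count =
    (λ { refl → cubic-Cycle≤5 G essential count , cubic-pentagon G essential count })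
  , λ δ≥4 → noOddClosedWalk⇒bipartite G connected (noOddClosedWalk G δ≥4 count)
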